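{- For every $n\geq 2$, the $2$-token graph $T_2(K_n)$ of the complete graph $K_n$ is well-covered.
   Context: The $2$-token graph $T_2(G)$ has as vertices the $2$-subsets of $V(G)$, two of them adjacent if their symmetric difference is an edge of $G$. A graph is well-covered if all of its maximal (with respect to inclusion) independent sets have the same cardinality. -}

module Defs where

open import Data.Nat using (ℕ; _<_)
open import Data.Fin using (Fin; toℕ)
open import Data.Product using (Σ; _×_; _,_; ∃₂; proj₁; proj₂)
open import Data.Sum using (_⊎_; inj₁; inj₂)
open import Data.Empty using (⊥)
open import Data.List using (List; length; _∷_)
open import Data.List.Membership.Propositional using (_∈_; _∉_)
open import Data.List.Relation.Unary.Unique.Propositional using (Unique)
open import Relation.Binary.PropositionalEquality using (_≡_; refl)
open import Relation.Nullary using (¬_)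
open import Level using (0ℓ)

record Graph (V : Set) : Set₁ where
  field
    Adj      : V → V → Set
    irrefl   : ∀ {x} → ¬ Adj x x
    sym      : ∀ {x y} → Adj x y → Adj y x

open Graph public

K : (n : ℕ) → Graph (Fin n)
K n = record { Adj = λ x y → ¬ x ≡ y ; irrefl = λ p → p _≡_.refl ; sym = λ p q → p (Relation.Binary.PropositionalEquality.sym q) }

-- 2-subsets of Fin n, represented uniquely as ordered pairs (i , j) with i < j.
TwoSet : ℕ → Set
TwoSet n = Σ (Fin n × Fin n) λ { (i , j) → toℕ i < toℕ j }

_∈₂_ : ∀ {n} → Fin n → TwoSet n → Set
x ∈₂ ((i , j) , _) = (x ≡ i) ⊎ (x ≡ j)

_∈Δ_,_ : ∀ {n} → Fin n → TwoSet n → TwoSet n → Set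
x ∈Δ A , B = (x ∈₂ A × ¬ (x ∈₂ B)) ⊎ (¬ (x ∈₂ A) × x ∈₂ B)

-- 2-token graph: A ~ B iff A Δ B = {a , b} with ab an edge of G.
T₂Adj : ∀ {n} → Graph (Fin n) → TwoSet n → TwoSet n → Set
T₂Adj G A B = ∃₂ λ a b → Adj G a b ×
  (∀ x → ((x ∈Δ A , B) → (x ≡ a ⊎ x ≡ b)) × ((x ≡ a ⊎ x ≡ b) → (x ∈Δ A , B)))

noΔ : ∀ {n} {A : TwoSet n} {x : Fin n} → ¬ (x ∈Δ A , A)
noΔ (inj₁ (p , q)) = q p
noΔ (inj₂ (p , q)) = p q

swapΔ : ∀ {n} {A B : TwoSet n} {x : Fin n} → x ∈Δ A , B → x ∈Δ B , A
swapΔ (inj₁ (p , q)) = inj₂ (q , p)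
swapΔ (inj₂ (p , q)) = inj₁ (q , p)

T₂-irrefl : ∀ {n} (G : Graph (Fin n)) {A : TwoSet n} → ¬ T₂Adj G A A
T₂-irrefl G {A} (a , b , _ , h) = noΔ {A = A} (proj₂ (h a) (inj₁ refl))

T₂-sym : ∀ {n} (G : Graph (Fin n)) {A B : TwoSet n} → T₂Adj G A B → T₂Adj G B A
T₂-sym G {A} {B} (a , b , e , h) =
  a , b , e , λ x → (λ d → proj₁ (h x) (swapΔ {A = B} {B = A} d)) , (λ d → swapΔ {A = A} {B = B} (proj₂ (h x) d))

T₂ : ∀ {n} → Graph (Fin n) → Graph (TwoSet n)
T₂ G = record { Adj = T₂Adj G ; irrefl = λ {A} → T₂-irrefl G {A} ; sym = λ {A} {B} → T₂-sym G {A} {B} }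

Independent : ∀ {V} → Graph V → List V → Set
Independent {V} G S = Unique S × (∀ {u v} → u ∈ S → v ∈ S → ¬ Adj G u v)

MaximalIndependent : ∀ {V} → Graph V → List V → Set
MaximalIndependent G S = Independent G S × (∀ v → v ∉ S → ¬ Independent G (v ∷ S))

WellCovered : ∀ {V} → Graph V → Set
WellCovered G = ∀ S S' → MaximalIndependent G S → MaximalIndependent G S' → length S ≡ length S'

-- Two 2-sets sharing exactly one point are adjacent in T₂(Kₙ) and disjoint ones are
-- not, so the independent sets of T₂(Kₙ) are exactly the matchings of Kₙ. A maximal
-- matching leaves at most one vertex uncovered, since two uncovered vertices could be
-- matched; hence every maximal independent set has ⌊ n /2⌋ elements.
module Submission where

open import Defs hiding (sym)
open import Data.Nat using (ℕ; _≥_; suc; _+_; _≤_; z≤n; s≤s; ⌊_/2⌋)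
open import Data.Nat.Properties using (<-irrefl; <-irrelevant; <-asym; <-cmp; +-suc; +-comm; +-identityʳ; n≡⌊n+n/2⌋)
open import Data.Fin using (Fin; toℕ; _≟_)
open import Data.Fin.Properties using (toℕ-injective)
open import Data.Product using (Σ; ∃; _×_; _,_; proj₁; proj₂)
open import Data.Sum using (_⊎_; inj₁; inj₂; [_,_]; swap)
open import Data.Empty using (⊥-elim)
open import Data.List using (List; []; _∷_; length; filter; allFin; _++_)
open import Data.List.Properties using (length-++; length-tabulate)
open import Data.List.Relation.Unary.Any using (here; there)
open import Data.List.Relation.Unary.All using (All; _∷_) renaming (lookup to All-lookup)
open import Data.List.Relation.Unary.All.Properties using (¬Any⇒All¬)
open import Data.List.Relation.Unary.AllPairs using ([]; _∷_)
open import Data.List.Relation.Unary.Unique.Propositional using (Unique)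
open import Data.List.Relation.Unary.Unique.Propositional.Properties using (allFin⁺; filter⁺; ++⁺)
open import Data.List.Relation.Binary.BagAndSetEquality using (∼bag⇒↭)
open import Data.List.Relation.Binary.Permutation.Propositional.Properties using (↭-length)
open import Data.List.Membership.Propositional using (_∈_; _∉_)
open import Data.List.Membership.Propositional.Properties using (∈-allFin; ∈-filter⁺; ∈-filter⁻; ∈-++⁺ˡ; ∈-++⁺ʳ)
open import Data.List.Membership.Propositional.Properties.WithK using (unique∧set⇒bag)
open import Function using (_∘_)
open import Function.Bundles using (_⇔_; mk⇔; Equivalence)
open import Relation.Binary using (tri<; tri≈; tri>)
open import Relation.Binary.PropositionalEquality using (_≡_; refl; sym; trans; cong; _≢_; module ≡-Reasoning)
open import Relation.Nullary using (¬_; yes; no; ¬?)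

open Equivalence using (to; from)

length-unique-≡ : {A : Set} {xs ys : List A} → Unique xs → Unique ys →
                  (∀ {z} → z ∈ xs ⇔ z ∈ ys) → length xs ≡ length ys
length-unique-≡ ux uy xs≈ys = ↭-length (∼bag⇒↭ (unique∧set⇒bag ux uy xs≈ys))

⌊double+≤1/2⌋ : ∀ a {u} → u ≤ 1 → ⌊ a + a + u /2⌋ ≡ a
⌊double+≤1/2⌋ a z≤n       = trans (cong ⌊_/2⌋ (+-identityʳ (a + a))) (sym (n≡⌊n+n/2⌋ a))
⌊double+≤1/2⌋ a (s≤s z≤n) = trans (cong ⌊_/2⌋ (+-comm (a + a) 1)) (⌊suc[a+a]/2⌋≡a a)
  where
  ⌊suc[a+a]/2⌋≡a : ∀ a → ⌊ suc (a + a) /2⌋ ≡ a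
  ⌊suc[a+a]/2⌋≡a 0       = refl
  ⌊suc[a+a]/2⌋≡a (suc a) = cong suc (trans (cong ⌊_/2⌋ (+-suc a a)) (⌊suc[a+a]/2⌋≡a a))

module _ {n : ℕ} where

  IsPair : TwoSet n → Fin n → Fin n → Set
  IsPair P x y = ∀ w → w ∈₂ P ⇔ (w ≡ x ⊎ w ≡ y)

  TwoSet-⊆⇒≡ : (P Q : TwoSet n) → (∀ w → w ∈₂ P → w ∈₂ Q) → P ≡ Q
  TwoSet-⊆⇒≡ ((i , j) , i<j) ((k , l) , k<l) P⊆Q with P⊆Q i (inj₁ refl) | P⊆Q j (inj₂ refl)
  ... | inj₁ refl | inj₁ refl = ⊥-elim (<-irrefl refl i<j)
  ... | inj₁ refl | inj₂ refl = cong ((i , j) ,_) (<-irrelevant i<j k<l)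
  ... | inj₂ refl | inj₁ refl = ⊥-elim (<-asym i<j k<l)
  ... | inj₂ refl | inj₂ refl = ⊥-elim (<-irrefl refl i<j)

  ∈₂⇒IsPair : (P : TwoSet n) {x : Fin n} → x ∈₂ P → ∃ λ y → x ≢ y × IsPair P x y
  ∈₂⇒IsPair ((i , j) , i<j) (inj₁ refl) =
    j , (λ i≡j → <-irrefl (cong toℕ i≡j) i<j) , λ w → mk⇔ (λ p → p) (λ p → p)
  ∈₂⇒IsPair ((i , j) , i<j) (inj₂ refl) =
    i , (λ j≡i → <-irrefl (cong toℕ (sym j≡i)) i<j) , λ w → mk⇔ swap swap

  pair : {u v : Fin n} → u ≢ v → Σ (TwoSet n) λ R → ∀ w → w ∈₂ R → w ≡ u ⊎ w ≡ v
  pair {u} {v} u≢v with <-cmp (toℕ u) (toℕ v)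
  ... | tri< u<v _ _ = ((u , v) , u<v) , λ w w∈R → w∈R
  ... | tri≈ _ u≡v _ = ⊥-elim (u≢v (toℕ-injective u≡v))
  ... | tri> _ _ v<u = ((v , u) , v<u) , λ w → swap

  IsPair⇒T₂Adj : (G : Graph (Fin n)) {P Q : TwoSet n} {x y z : Fin n} → Adj G y z →
                 IsPair P x y → IsPair Q x z → x ≢ y → x ≢ z → T₂Adj G P Q
  IsPair⇒T₂Adj G {P} {Q} {x} {y} {z} yz P≐xy Q≐xz x≢y x≢z = y , z , yz , λ w → Δ⇒yz w , yz⇒Δ w
    where
    y≢z : y ≢ z
    y≢z refl = irrefl G yz
    Δ⇒yz : ∀ w → w ∈Δ P , Q → w ≡ y ⊎ w ≡ z
    Δ⇒yz w (inj₁ (w∈P , w∉Q)) =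
      [ (λ w≡x → ⊥-elim (w∉Q (from (Q≐xz w) (inj₁ w≡x)))) , inj₁ ] (to (P≐xy w) w∈P)
    Δ⇒yz w (inj₂ (w∉P , w∈Q)) =
      [ (λ w≡x → ⊥-elim (w∉P (from (P≐xy w) (inj₁ w≡x)))) , inj₂ ] (to (Q≐xz w) w∈Q)
    yz⇒Δ : ∀ w → w ≡ y ⊎ w ≡ z → w ∈Δ P , Q
    yz⇒Δ w (inj₁ refl) =
      inj₁ (from (P≐xy w) (inj₂ refl) , [ (λ w≡x → x≢y (sym w≡x)) , y≢z ] ∘ to (Q≐xz w))
    yz⇒Δ w (inj₂ refl) =
      inj₂ ([ (λ w≡x → x≢z (sym w≡x)) , (λ w≡y → y≢z (sym w≡y)) ] ∘ to (P≐xy w) , from (Q≐xz w) (inj₂ refl))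

  common-point⇒≡ : (P Q : TwoSet n) {x : Fin n} → x ∈₂ P → x ∈₂ Q → ¬ T₂Adj (K n) P Q → P ≡ Q
  common-point⇒≡ P Q x∈P x∈Q ¬adj with ∈₂⇒IsPair P x∈P | ∈₂⇒IsPair Q x∈Q
  ... | y , x≢y , P≐xy | z , x≢z , Q≐xz with y ≟ z
  ... | yes refl = TwoSet-⊆⇒≡ P Q λ w w∈P → from (Q≐xz w) (to (P≐xy w) w∈P)
  ... | no y≢z   = ⊥-elim (¬adj (IsPair⇒T₂Adj (K n) {P} {Q} y≢z P≐xy Q≐xz x≢y x≢z))

  -- Both points of P lie in the symmetric difference, so they exhaust the two-element
  -- set {a , b}; a point of Q there would then be shared with P.
  disjoint⇒¬T₂Adj : (G : Graph (Fin n)) (P Q : TwoSet n) → (∀ w → w ∈₂ P → ¬ w ∈₂ Q) → ¬ T₂Adj G P Q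
  disjoint⇒¬T₂Adj G ((i , j) , i<j) ((k , l) , k<l) disj (a , b , _ , Δ≡ab)
    with proj₁ (Δ≡ab i) (inj₁ (inj₁ refl , disj i (inj₁ refl)))
       | proj₁ (Δ≡ab j) (inj₁ (inj₂ refl , disj j (inj₂ refl)))
       | proj₁ (Δ≡ab k) (inj₂ ((λ k∈P → disj k k∈P (inj₁ refl)) , inj₁ refl))
  ... | inj₁ refl | inj₁ refl | _         = <-irrefl refl i<j
  ... | inj₂ refl | inj₂ refl | _         = <-irrefl refl i<j
  ... | inj₁ refl | inj₂ refl | inj₁ refl = disj k (inj₁ refl) (inj₁ refl)
  ... | inj₁ refl | inj₂ refl | inj₂ refl = disj k (inj₂ refl) (inj₁ refl)
  ... | inj₂ refl | inj₁ refl | inj₁ refl = disj k (inj₂ refl) (inj₁ refl)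
  ... | inj₂ refl | inj₁ refl | inj₂ refl = disj k (inj₁ refl) (inj₁ refl)

  points : List (TwoSet n) → List (Fin n)
  points []                  = []
  points (((i , j) , _) ∷ S) = i ∷ j ∷ points S

  length-points : (S : List (TwoSet n)) → length (points S) ≡ length S + length S
  length-points []      = refl
  length-points (_ ∷ S) = cong suc (trans (cong suc (length-points S)) (sym (+-suc (length S) (length S))))

  ∈-points⁺ : {S : List (TwoSet n)} {Q : TwoSet n} {x : Fin n} → Q ∈ S → x ∈₂ Q → x ∈ points S
  ∈-points⁺ (here refl) (inj₁ refl) = here refl
  ∈-points⁺ (here refl) (inj₂ refl) = there (here refl)
  ∈-points⁺ {_ ∷ _} (there Q∈S) x∈Q = there (there (∈-points⁺ Q∈S x∈Q))

  ∈-points⁻ : {S : List (TwoSet n)} {x : Fin n} → x ∈ points S → ∃ λ Q → Q ∈ S × x ∈₂ Q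
  ∈-points⁻ {_ ∷ _} (here x≡i)          = _ , here refl , inj₁ x≡i
  ∈-points⁻ {_ ∷ _} (there (here x≡j))  = _ , here refl , inj₂ x≡j
  ∈-points⁻ {_ ∷ _} (there (there x∈S)) with ∈-points⁻ x∈S
  ... | Q , Q∈S , x∈Q = Q , there Q∈S , x∈Q

  independent⇒unique-points : (S : List (TwoSet n)) → Independent (T₂ (K n)) S → Unique (points S)
  independent⇒unique-points [] _ = []
  independent⇒unique-points (P@((i , j) , i<j) ∷ S) ((P∉S ∷ uniqueS) , ¬adj) =
    ((λ i≡j → <-irrefl (cong toℕ i≡j) i<j) ∷ ∉points (inj₁ refl))
    ∷ ∉points (inj₂ refl)
    ∷ independent⇒unique-points S (uniqueS , λ u∈S v∈S → ¬adj (there u∈S) (there v∈S))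
    where
    ∉points : ∀ {x} → x ∈₂ P → All (x ≢_) (points S)
    ∉points {x} x∈P = ¬Any⇒All¬ (points S) λ x∈pts →
      let Q , Q∈S , x∈Q = ∈-points⁻ x∈pts
      in All-lookup P∉S Q∈S (common-point⇒≡ P Q x∈P x∈Q (¬adj (here refl) (there Q∈S)))

  open import Data.List.Membership.DecPropositional (_≟_ {n}) using (_∈?_)

  uncovered : List (TwoSet n) → List (Fin n)
  uncovered S = filter (λ x → ¬? (x ∈? points S)) (allFin n)

  unique-uncovered : (S : List (TwoSet n)) → Unique (uncovered S)
  unique-uncovered S = filter⁺ (λ x → ¬? (x ∈? points S)) (allFin⁺ n)

  ∈-uncovered⇒∉ : (S : List (TwoSet n)) {x : Fin n} → x ∈ uncovered S → x ∉ points S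
  ∈-uncovered⇒∉ S = proj₂ ∘ ∈-filter⁻ (λ x → ¬? (x ∈? points S)) {xs = allFin n}

  points+uncovered≡n : (S : List (TwoSet n)) → Unique (points S) →
                       length (points S) + length (uncovered S) ≡ n
  points+uncovered≡n S unique-points = begin
    length (points S) + length (uncovered S) ≡⟨ sym (length-++ (points S)) ⟩
    length (points S ++ uncovered S)         ≡⟨ length-unique-≡ unique-++ (allFin⁺ n) (mk⇔ (λ _ → ∈-allFin _) cover) ⟩
    length (allFin n)                        ≡⟨ length-tabulate (λ x → x) ⟩
    n                                        ∎
    where
    open ≡-Reasoning
    unique-++ : Unique (points S ++ uncovered S)
    unique-++ = ++⁺ unique-points (unique-uncovered S) λ (x∈pts , x∈unc) → ∈-uncovered⇒∉ S x∈unc x∈pts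
    cover : ∀ {x} → x ∈ allFin n → x ∈ points S ++ uncovered S
    cover {x} x∈all with x ∈? points S
    ... | yes x∈pts = ∈-++⁺ˡ x∈pts
    ... | no  x∉pts = ∈-++⁺ʳ (points S) (∈-filter⁺ (λ x → ¬? (x ∈? points S)) x∈all x∉pts)

  maximal⇒meets : (S : List (TwoSet n)) → MaximalIndependent (T₂ (K n)) S →
                  (R : TwoSet n) → ¬ (∀ w → w ∈₂ R → w ∉ points S)
  maximal⇒meets S ((uniqueS , ¬adj) , maximal) R@((x , _) , _) R∩S≡∅ =
    maximal R R∉S (¬Any⇒All¬ S R∉S ∷ uniqueS , ¬adj′)
    where
    R∉S : R ∉ S
    R∉S R∈S = R∩S≡∅ x (inj₁ refl) (∈-points⁺ R∈S (inj₁ refl))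
    R-disjoint : ∀ {Q} → Q ∈ S → ¬ T₂Adj (K n) R Q
    R-disjoint {Q} Q∈S = disjoint⇒¬T₂Adj (K n) R Q λ w w∈R w∈Q → R∩S≡∅ w w∈R (∈-points⁺ Q∈S w∈Q)
    ¬adj′ : ∀ {P Q} → P ∈ R ∷ S → Q ∈ R ∷ S → ¬ T₂Adj (K n) P Q
    ¬adj′ (here refl)     (here refl)  = T₂-irrefl (K n) {R}
    ¬adj′ (here refl)     (there Q∈S)  = R-disjoint Q∈S
    ¬adj′ {P} (there P∈S) (here refl)  = R-disjoint P∈S ∘ T₂-sym (K n) {P} {R}
    ¬adj′ (there P∈S)     (there Q∈S)  = ¬adj P∈S Q∈S

  maximal⇒uncovered≤1 : (S : List (TwoSet n)) → MaximalIndependent (T₂ (K n)) S → length (uncovered S) ≤ 1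
  maximal⇒uncovered≤1 S maxS = at-most-one (uncovered S) (unique-uncovered S) (∈-uncovered⇒∉ S)
    where
    at-most-one : (U : List (Fin n)) → Unique U → (∀ {x} → x ∈ U → x ∉ points S) → length U ≤ 1
    at-most-one []          _ _ = z≤n
    at-most-one (_ ∷ [])    _ _ = s≤s z≤n
    at-most-one (u ∷ v ∷ _) ((u≢v ∷ _) ∷ _) U∩S≡∅ =
      let R , R⊆uv = pair u≢v
      in ⊥-elim (maximal⇒meets S maxS R λ w w∈R →
           [ (λ { refl → U∩S≡∅ (here refl) }) , (λ { refl → U∩S≡∅ (there (here refl)) }) ] (R⊆uv w w∈R))

  maximal-independent-length : (S : List (TwoSet n)) → MaximalIndependent (T₂ (K n)) S → length S ≡ ⌊ n /2⌋
  maximal-independent-length S maxS = begin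
    length S                                         ≡⟨ sym (⌊double+≤1/2⌋ (length S) (maximal⇒uncovered≤1 S maxS)) ⟩
    ⌊ length S + length S + length (uncovered S) /2⌋ ≡⟨ cong (λ m → ⌊ m + length (uncovered S) /2⌋) (sym (length-points S)) ⟩
    ⌊ length (points S) + length (uncovered S) /2⌋   ≡⟨ cong ⌊_/2⌋ (points+uncovered≡n S unique-points) ⟩
    ⌊ n /2⌋                                          ∎
    where
    open ≡-Reasoning
    unique-points : Unique (points S)
    unique-points = independent⇒unique-points S (proj₁ maxS)

theorem6p1 : (n : ℕ) → n ≥ 2 → WellCovered (T₂ (K n))
theorem6p1 n _ S S′ maxS maxS′ =
  trans (maximal-independent-length S maxS) (sym (maximal-independent-length S′ maxS′))
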